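{- Let $V$ be any finite alphabet with at least two distinct letters. Then the language $Q_{\overline{I}}$ over $V$ is not context-free.
   Context: $V^*$ is the set of all finite words over $V$. A nonempty word $w$ is primitive if it is not of the form $v^n$ for a word $v$ and an integer $n \ge 2$; $Q$ is the set of primitive words over $V$. For a word $w$ of length $n$, $w[1..i]$ denotes its prefix of length $i$ and $w[i+1..n]$ its suffix of length $n-i$. A primitive word $w$ of length $n$ is ins-robust if for every $i \in \{0,\ldots,n\}$ and every $c \in V$ the word $w[1..i]\,c\,w[i+1..n]$ is primitive; $Q_I$ is the set of ins-robust primitive words over $V$ and $Q_{\overline{I}} = Q \setminus Q_I$. -}

module Defs where

open import Data.Nat using (ℕ; _≤_)
open import Data.Fin using (Fin)
open import Data.List using (List; []; _∷_; _++_; concat; replicate; length; take; drop)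
open import Data.List.Membership.Propositional using (_∈_)
open import Data.Product using (Σ; _×_; _,_)
open import Data.Sum using (_⊎_; inj₁; inj₂)
open import Relation.Nullary using (¬_)
open import Relation.Binary.PropositionalEquality using (_≡_)

_^ʷ_ : {V : Set} → List V → ℕ → List V
v ^ʷ n = concat (replicate n v)

Primitive : {V : Set} → List V → Set
Primitive w = ¬ (w ≡ []) × ¬ (Σ _ λ v → Σ ℕ λ n → (2 ≤ n) × (w ≡ v ^ʷ n))

insertAt : {V : Set} → ℕ → List _ → V → List V
insertAt i w c = take i w ++ (c ∷ drop i w)

InsRobust : {V : Set} → List V → Set
InsRobust {V} w = Primitive w × ((i : ℕ) → i ≤ length w → (c : V) → Primitive (insertAt i w c))

QIbar : {V : Set} → List V → Set
QIbar w = Primitive w × ¬ InsRobust w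

record CFG (V : Set) : Set where
  field
    nN    : ℕ
    rules : List (Fin nN × List (Fin nN ⊎ V))
    start : Fin nN

data Derives {V : Set} (G : CFG V) : List (Fin (CFG.nN G) ⊎ V) → List V → Set where
  nil  : Derives G [] []
  term : ∀ {a α w} → Derives G α w → Derives G (inj₂ a ∷ α) (a ∷ w)
  nont : ∀ {A β α u w} → (A , β) ∈ CFG.rules G → Derives G β u → Derives G α w →
         Derives G (inj₁ A ∷ α) (u ++ w)

Generates : {V : Set} → CFG V → List V → Set
Generates G w = Derives G (inj₁ (CFG.start G) ∷ []) w

ContextFree : {V : Set} → (List V → Set) → Set
ContextFree {V} L = Σ (CFG V) λ G → ∀ w → (Generates G w → L w) × (L w → Generates G w)

-- A word over {a, b} whose letter counts (m, n) satisfy gcd(m, n) = gcd(m + 1, n) = gcd(m, n + 1) = 1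
-- is ins-robust, since all letter counts of a power v^k are divisible by k. Let L be the pumping constant
-- of a grammar for Q_Ī, N = L (L + 2), K = N! and β = K + 1, so that β ≡ 1 modulo every number up to N.
-- The word b a^c (a b a^c)^K with c = L (β + 1) + β has the coprime counts α = (L + 1) β (β + 1) − 1 and β,
-- so it is primitive, while prepending a turns it into (a b a^c)^β. Pumping it j + 1 times yields counts
-- (α + j s, β + j t) with 1 ≤ s + t ≤ L. If t > 0, let j be the product of t α − s β, t α − s (β + 1) and
-- (t (α + 1) − s β) / β, all coprime to β. A common divisor of a pumped pair divides the corresponding
-- determinant, hence j, and then also the unpumped pair; this forces it to be 1 (for the pair (α + 1, β),
-- whose gcd is β, this uses that j t is prime to β). For t = 0, j = 2 (β + 1) works. The pumped word is
-- then ins-robust although the grammar generates it.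

module Submission where

open import Defs
open import Data.Fin as Fin using (Fin)
open import Data.Fin.Subset using (Subset; ⊤; ∣_∣; _-_) renaming (_∈_ to _∈ₛ_)
open import Data.Fin.Subset.Properties using (∣⊤∣≡n; ∈⊤; x∈p⇒∣p-x∣<∣p∣; x∈p∧x≢y⇒x∈p-y)
open import Data.List using (List; []; _∷_; _++_; length; map; replicate; take; drop)
open import Data.List.Properties
  using (++-assoc; ++-identityʳ; length-++; length-++-≤ˡ; length-++-≤ʳ; length-replicate; take++drop≡id)
open import Data.List.Membership.Propositional using (_∈_)
open import Data.List.Relation.Unary.All using (All; []; _∷_)
open import Data.List.Relation.Unary.All.Properties using (++⁺; ++⁻ˡ; ++⁻ʳ; concat⁺; replicate⁺)
open import Data.List.Relation.Unary.Any using (Any; here; there; any?; satisfied)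
open import Data.List.Relation.Unary.Any.Properties using (map⁺)
open import Data.Nat
open import Data.Nat.Properties
open import Algebra.Properties.CommutativeSemigroup +-commutativeSemigroup using (x∙yz≈y∙xz; interchange)
open import Data.Nat.Coprimality using (Coprime; coprime-divisor) renaming (sym to coprime-sym)
open import Data.Nat.Divisibility
open import Data.Nat.Tactic.RingSolver using (solve-∀)
open import Data.Product using (Σ; Σ-syntax; ∃-syntax; _×_; _,_; proj₁; proj₂)
open import Data.Sum as Sum using (_⊎_; inj₁; inj₂)
open import Function.Base using (_∘_)
open import Function.Bundles using (_↔_)
open import Function.Properties.Inverse using (↔⇒↣)
open import Relation.Binary.Definitions using (DecidableEquality)
open import Relation.Binary.PropositionalEquality
open import Relation.Nullary using (¬_; yes; no; contradiction)
open import Relation.Nullary.Decidable using (via-injection)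

∣m+n∣n⇒∣m : ∀ {d m n} → d ∣ m + n → d ∣ n → d ∣ m
∣m+n∣n⇒∣m {d} {m} {n} d∣m+n = ∣m+n∣m⇒∣n (subst (d ∣_) (+-comm m n) d∣m+n)

m≤n⇒m∣n! : ∀ {m n} → 1 ≤ m → m ≤ n → m ∣ n !
m≤n⇒m∣n! {suc m} _ m≤n = ∣-trans (m∣m*n (m !)) (m≤n⇒m!∣n! m≤n)

coprime-* : ∀ {m x y} → Coprime m x → Coprime m y → Coprime m (x * y)
coprime-* {m} {x} m⊥x m⊥y (d∣m , d∣xy) = m⊥y (d∣m , coprime-divisor d⊥x d∣xy)
  where
    d⊥x : Coprime _ x
    d⊥x (e∣d , e∣x) = m⊥x (∣-trans e∣d d∣m , e∣x)

∣suc⇒coprime : ∀ {m x} → m ∣ suc x → Coprime x m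
∣suc⇒coprime m∣1+x (d∣x , d∣m) = ∣1⇒≡1 (∣m+n∣n⇒∣m (∣-trans d∣m m∣1+x) d∣x)

coprime-complement : ∀ {m r x} → Coprime m r → m ∣ x + r → Coprime m x
coprime-complement m⊥r m∣x+r (d∣m , d∣x) = m⊥r (d∣m , ∣m+n∣m⇒∣n (∣-trans d∣m m∣x+r) d∣x)

coprime-residue : ∀ {m r x q} → Coprime m r → x ≡ m * q + r → Coprime m x
coprime-residue {q = q} m⊥r refl (d∣m , d∣x) = m⊥r (d∣m , ∣m+n∣m⇒∣n d∣x (∣m⇒∣m*n q d∣m))

coprime-1+n! : ∀ {n r} → 1 ≤ r → r ≤ n → Coprime (suc (n !)) r
coprime-1+n! 1≤r r≤n (d∣1+n! , d∣r) =
  ∣1⇒≡1 (∣m+n∣n⇒∣m d∣1+n! (∣-trans d∣r (m≤n⇒m∣n! 1≤r r≤n)))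

-- D stands for the determinant t a − s b, which is kept on the other side to avoid truncated subtraction.
∣-det : ∀ {n a b s t j D} → n ∣ a + j * s → n ∣ b + j * t → t * a ≡ D + s * b → n ∣ D
∣-det {n} {a} {b} {s} {t} {j} {D} n∣a′ n∣b′ det =
  ∣m+n∣n⇒∣m (subst (n ∣_) shifted (∣n⇒∣m*n t n∣a′)) (∣n⇒∣m*n s n∣b′)
  where
    open ≡-Reasoning
    shifted : t * (a + j * s) ≡ D + s * (b + j * t)
    shifted = begin
      t * (a + j * s)          ≡⟨ distribute t a j s ⟩
      t * a + s * (j * t)      ≡⟨ cong (_+ s * (j * t)) det ⟩
      D + s * b + s * (j * t)  ≡⟨ collect D s b (j * t) ⟩
      D + s * (b + j * t)      ∎
      where
        distribute : ∀ t a j s → t * (a + j * s) ≡ t * a + s * (j * t)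
        distribute = solve-∀
        collect : ∀ D s b x → D + s * b + s * x ≡ D + s * (b + x)
        collect = solve-∀

coprime-translate : ∀ {a b s t j D} → Coprime a b → t * a ≡ D + s * b → D ∣ j →
                    Coprime (a + j * s) (b + j * t)
coprime-translate {a} {b} {s} {t} {j} a⊥b det D∣j {n} (n∣a′ , n∣b′) =
  a⊥b (∣m+n∣n⇒∣m n∣a′ (∣m⇒∣m*n s n∣j) , ∣m+n∣n⇒∣m n∣b′ (∣m⇒∣m*n t n∣j))
  where
    n∣j : n ∣ j
    n∣j = ∣-trans (∣-det {a = a} {b} {s} {t} {j} n∣a′ n∣b′ det) D∣j

-- The determinant b F is not coprime to b; instead, j t being coprime to b makes every common
-- divisor coprime to b, hence a divisor of F and of j.
coprime-translate-multiple : ∀ {a b s t j F} → Coprime b (j * t) → t * a ≡ b * F + s * b → F ∣ j →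
                             Coprime (a + j * s) (b + j * t)
coprime-translate-multiple {a} {b} {s} {t} {j} b⊥jt det F∣j {n} (n∣a′ , n∣b′) = b⊥jt (n∣b , n∣jt)
  where
    n⊥b : Coprime n b
    n⊥b (d∣n , d∣b) = b⊥jt (d∣b , ∣m+n∣m⇒∣n (∣-trans d∣n n∣b′) d∣b)
    n∣jt : n ∣ j * t
    n∣jt = ∣m⇒∣m*n t (∣-trans (coprime-divisor n⊥b (∣-det {a = a} {b} {s} {t} {j} n∣a′ n∣b′ det)) F∣j)
    n∣b : n ∣ b
    n∣b = ∣m+n∣n⇒∣m n∣b′ n∣jt

RobustlyCoprime : ℕ → ℕ → Set
RobustlyCoprime x y = Coprime x y × Coprime (suc x) y × Coprime x (suc y)

module Exponents (p : ℕ) where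

  N : ℕ
  N = p * suc (suc p)

  K : ℕ
  K = N !

  β : ℕ
  β = suc K

  α : ℕ
  α = β + (K + p * β) * suc β

  α-suc : suc α ≡ suc p * β * suc β
  α-suc = identity K p
    where
      identity : ∀ K p → suc (suc K + (K + p * suc K) * suc (suc K)) ≡ suc p * suc K * suc (suc K)
      identity = solve-∀

  α⊥β : Coprime α β
  α⊥β = ∣suc⇒coprime (subst (β ∣_) (sym α-suc) (n∣m*n*o (suc p) (suc β)))

  α⊥1+β : Coprime α (suc β)
  α⊥1+β = ∣suc⇒coprime (subst (suc β ∣_) (sym α-suc) (n∣m*n (suc p * β)))

  β⊥small : ∀ {r} → 1 ≤ r → r ≤ N → Coprime β r
  β⊥small = coprime-1+n!

  p≤N : p ≤ N
  p≤N = m≤m*n p (suc (suc p))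

  p*1+p≤N : p * suc p ≤ N
  p*1+p≤N = *-monoʳ-≤ p (n≤1+n (suc p))

  2p≤N : 2 * p ≤ N
  2p≤N = subst (_≤ N) (*-comm p 2) (*-monoʳ-≤ p (s≤s (s≤s z≤n)))

  -- With j = 2 (β + 1), α + j s is 2 s − 1 and α + 1 + j s is 2 s modulo β, while β + 1 divides α + 1 + j s.
  module Horizontal (s′ : ℕ) (s≤p : suc s′ ≤ p) where

    j : ℕ
    j = 2 * suc β

    q : ℕ
    q = suc p * suc β + 2 * suc s′

    shifted : suc (α + j * suc s′) ≡ β * q + 2 * suc s′
    shifted = begin
      suc α + j * suc s′                        ≡⟨ cong (_+ j * suc s′) α-suc ⟩
      suc p * β * suc β + 2 * suc β * suc s′    ≡⟨ identity p β s′ ⟩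
      β * (suc p * suc β + 2 * suc s′) + 2 * suc s′ ∎
      where
        open ≡-Reasoning
        identity : ∀ p β s′ → suc p * β * suc β + 2 * suc β * suc s′ ≡
                              β * (suc p * suc β + 2 * suc s′) + 2 * suc s′
        identity = solve-∀

    unshifted : α + j * suc s′ ≡ β * q + suc (2 * s′)
    unshifted = suc-injective (begin
      suc (α + j * suc s′)         ≡⟨ shifted ⟩
      β * q + 2 * suc s′           ≡⟨ identity (β * q) s′ ⟩
      suc (β * q + suc (2 * s′))   ∎)
      where
        open ≡-Reasoning
        identity : ∀ x s′ → x + 2 * suc s′ ≡ suc (x + suc (2 * s′))
        identity = solve-∀

    multiple : suc (α + j * suc s′) ≡ suc β * (suc p * β + 2 * suc s′)
    multiple = begin
      suc α + j * suc s′                      ≡⟨ cong (_+ j * suc s′) α-suc ⟩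
      suc p * β * suc β + 2 * suc β * suc s′  ≡⟨ identity p β s′ ⟩
      suc β * (suc p * β + 2 * suc s′)        ∎
      where
        open ≡-Reasoning
        identity : ∀ p β s′ → suc p * β * suc β + 2 * suc β * suc s′ ≡ suc β * (suc p * β + 2 * suc s′)
        identity = solve-∀

    2s≤N : 2 * suc s′ ≤ N
    2s≤N = ≤-trans (*-monoʳ-≤ 2 s≤p) 2p≤N

    β⊥2s : Coprime β (2 * suc s′)
    β⊥2s = β⊥small (s≤s z≤n) 2s≤N

    β⊥2s-1 : Coprime β (suc (2 * s′))
    β⊥2s-1 = β⊥small (s≤s z≤n) (≤-trans (n≤1+n _) (subst (_≤ N) (*-suc 2 s′) 2s≤N))

    robust : RobustlyCoprime (α + j * suc s′) β
    robust = coprime-sym (coprime-residue {q = q} β⊥2s-1 unshifted)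
           , coprime-sym (coprime-residue {q = q} β⊥2s shifted)
           , ∣suc⇒coprime (subst (suc β ∣_) (sym multiple) (m∣m*n (suc p * β + 2 * suc s′)))

  -- D, E and β F are the determinants t α − s β, t α − s (β + 1) and t (α + 1) − s β; modulo β
  -- they are −t, −(s + t) and 0, with F ≡ r = t (p + 1) − s, where 0 < r ≤ N thanks to the factor p + 1 in α + 1.
  module Sloped (s t′ : ℕ) (s+t≤p : s + suc t′ ≤ p) where

    t : ℕ
    t = suc t′

    E : ℕ
    E = t * α ∸ s * suc β

    D : ℕ
    D = E + s

    r : ℕ
    r = t * suc p ∸ s

    F : ℕ
    F = β * (t * suc p) + r

    j : ℕ
    j = D * E * F

    s≤p : s ≤ p
    s≤p = m+n≤o⇒m≤o s s+t≤p

    t≤p : t ≤ p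
    t≤p = m+n≤o⇒n≤o s s+t≤p

    s*1+β≤t*α : s * suc β ≤ t * α
    s*1+β≤t*α = begin
      s * suc β              ≤⟨ *-monoˡ-≤ (suc β) s≤p ⟩
      p * suc β              ≤⟨ *-monoˡ-≤ (suc β) (≤-trans (m≤m*n p β) (m≤n+m (p * β) K)) ⟩
      (K + p * β) * suc β    ≤⟨ m≤n+m _ β ⟩
      α                      ≤⟨ m≤n*m α t ⟩
      t * α                  ∎
      where open ≤-Reasoning

    s<t*1+p : s < t * suc p
    s<t*1+p = ≤-<-trans s≤p (<-≤-trans (n<1+n p) (m≤n*m (suc p) t))

    det-E : t * α ≡ E + s * suc β
    det-E = sym (m∸n+n≡m s*1+β≤t*α)

    det-D : t * α ≡ D + s * β
    det-D = trans det-E (identity E s β)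
      where
        identity : ∀ E s β → E + s * suc β ≡ E + s + s * β
        identity = solve-∀

    det-F : t * suc α ≡ β * F + s * β
    det-F = begin
      t * suc α                            ≡⟨ cong (t *_) α-suc ⟩
      t * (suc p * β * suc β)              ≡⟨ identity₁ t p β ⟩
      β * (β * (t * suc p) + t * suc p)    ≡⟨ cong (λ x → β * (β * (t * suc p) + x)) (m∸n+n≡m (<⇒≤ s<t*1+p)) ⟨
      β * (β * (t * suc p) + (r + s))      ≡⟨ identity₂ β (t * suc p) r s ⟩
      β * F + s * β                        ∎
      where
        open ≡-Reasoning
        identity₁ : ∀ t p β → t * (suc p * β * suc β) ≡ β * (β * (t * suc p) + t * suc p)
        identity₁ = solve-∀
        identity₂ : ∀ β x r s → β * (β * x + (r + s)) ≡ β * (β * x + r) + s * β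
        identity₂ = solve-∀

    D+t≡βF : D + t ≡ β * F
    D+t≡βF = +-cancelʳ-≡ (s * β) (D + t) (β * F) (begin
      D + t + s * β    ≡⟨ identity D t (s * β) ⟩
      t + (D + s * β)  ≡⟨ cong (t +_) (sym det-D) ⟩
      t + t * α        ≡⟨ *-suc t α ⟨
      t * suc α        ≡⟨ det-F ⟩
      β * F + s * β    ∎)
      where
        open ≡-Reasoning
        identity : ∀ D t x → D + t + x ≡ t + (D + x)
        identity = solve-∀

    β⊥t : Coprime β t
    β⊥t = β⊥small (s≤s z≤n) (≤-trans t≤p p≤N)

    β⊥D : Coprime β D
    β⊥D = coprime-complement β⊥t (subst (β ∣_) (sym D+t≡βF) (m∣m*n F))

    β⊥E : Coprime β E
    β⊥E = coprime-complement (β⊥small (≤-trans (s≤s z≤n) (m≤n+m t s)) (≤-trans s+t≤p p≤N))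
            (subst (β ∣_) (trans (sym D+t≡βF) (+-assoc E s t)) (m∣m*n F))

    β⊥F : Coprime β F
    β⊥F = coprime-residue {q = t * suc p} (β⊥small (m<n⇒0<n∸m s<t*1+p) r≤N) refl
      where
        r≤N : r ≤ N
        r≤N = ≤-trans (m∸n≤m _ s) (≤-trans (*-monoˡ-≤ (suc p) t≤p) p*1+p≤N)

    robust : RobustlyCoprime (α + j * s) (β + j * t)
    robust = coprime-translate {s = s} {t} {j} α⊥β det-D (∣m⇒∣m*n F (m∣m*n E))
           , coprime-translate-multiple {s = s} {t} {j}
               (coprime-* (coprime-* (coprime-* β⊥D β⊥E) β⊥F) β⊥t) det-F (n∣m*n (D * E))
           , coprime-translate {s = s} {t} {j} α⊥1+β det-E (∣m⇒∣m*n F (n∣m*n D))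

  translate : ∀ s t → 1 ≤ s + t → s + t ≤ p → ∃[ j ] RobustlyCoprime (α + j * s) (β + j * t)
  translate zero     zero     ()
  translate s        (suc t′) _ s+t≤p = Sloped.j s t′ s+t≤p , Sloped.robust s t′ s+t≤p
  translate (suc s′) zero     _ s+0≤p =
    j , subst (RobustlyCoprime (α + j * suc s′)) (sym (trans (cong (β +_) (*-zeroʳ j)) (+-identityʳ β))) robust
    where open Horizontal s′ (subst (_≤ p) (+-identityʳ (suc s′)) s+0≤p)

module Counting {V : Set} (_≟_ : DecidableEquality V) where

  count : V → List V → ℕ
  count c []      = 0
  count c (d ∷ w) with c ≟ d
  ... | yes _ = suc (count c w)
  ... | no  _ = count c w

  count-∷-≡ : ∀ c w → count c (c ∷ w) ≡ suc (count c w)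
  count-∷-≡ c w with c ≟ c
  ... | yes _   = refl
  ... | no  c≢c = contradiction refl c≢c

  count-∷-≢ : ∀ {c d} w → c ≢ d → count c (d ∷ w) ≡ count c w
  count-∷-≢ {c} {d} w c≢d with c ≟ d
  ... | yes c≡d = contradiction c≡d c≢d
  ... | no  _   = refl

  count-∷ : ∀ c d w → count c (d ∷ w) ≡ count c (d ∷ []) + count c w
  count-∷ c d w with c ≟ d
  ... | yes _ = refl
  ... | no  _ = refl

  count-replicate-≡ : ∀ c n → count c (replicate n c) ≡ n
  count-replicate-≡ c zero    = refl
  count-replicate-≡ c (suc n) = trans (count-∷-≡ c (replicate n c)) (cong suc (count-replicate-≡ c n))

  count-replicate-≢ : ∀ {c d} n → c ≢ d → count c (replicate n d) ≡ 0
  count-replicate-≢ zero    c≢d = refl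
  count-replicate-≢ (suc n) c≢d = trans (count-∷-≢ _ c≢d) (count-replicate-≢ n c≢d)

  count-++ : ∀ c u v → count c (u ++ v) ≡ count c u + count c v
  count-++ c []      v = refl
  count-++ c (d ∷ u) v = begin
    count c (d ∷ u ++ v)                      ≡⟨ count-∷ c d (u ++ v) ⟩
    count c (d ∷ []) + count c (u ++ v)       ≡⟨ cong (count c (d ∷ []) +_) (count-++ c u v) ⟩
    count c (d ∷ []) + (count c u + count c v) ≡⟨ +-assoc (count c (d ∷ [])) _ _ ⟨
    count c (d ∷ []) + count c u + count c v  ≡⟨ cong (_+ count c v) (count-∷ c d u) ⟨
    count c (d ∷ u) + count c v               ∎
    where open ≡-Reasoning

  count-^ʷ : ∀ c v n → count c (v ^ʷ n) ≡ n * count c v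
  count-^ʷ c v zero    = refl
  count-^ʷ c v (suc n) = trans (count-++ c v (v ^ʷ n)) (cong (count c v +_) (count-^ʷ c v n))

  count-++-∷ : ∀ c u d v → count c (u ++ d ∷ v) ≡ count c (d ∷ u ++ v)
  count-++-∷ c u d v = begin
    count c (u ++ d ∷ v)                          ≡⟨ count-++ c u (d ∷ v) ⟩
    count c u + count c (d ∷ v)                   ≡⟨ cong (count c u +_) (count-∷ c d v) ⟩
    count c u + (count c (d ∷ []) + count c v)    ≡⟨ x∙yz≈y∙xz (count c u) (count c (d ∷ [])) (count c v) ⟩
    count c (d ∷ []) + (count c u + count c v)    ≡⟨ cong (count c (d ∷ []) +_) (count-++ c u v) ⟨
    count c (d ∷ []) + count c (u ++ v)           ≡⟨ count-∷ c d (u ++ v) ⟨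
    count c (d ∷ u ++ v)                          ∎
    where open ≡-Reasoning

  count-insertAt : ∀ c i w d → count c (insertAt i w d) ≡ count c (d ∷ w)
  count-insertAt c i w d =
    trans (count-++-∷ c (take i w) d (drop i w)) (cong (λ v → count c (d ∷ v)) (take++drop≡id i w))

  count-pumped : ∀ c u v x y z j →
                 count c (u ++ (v ^ʷ suc j ++ x ++ y ^ʷ suc j) ++ z) ≡
                 count c (u ++ (v ++ x ++ y) ++ z) + j * (count c v + count c y)
  count-pumped c u v x y z j = begin
    count c (u ++ (v ^ʷ suc j ++ x ++ y ^ʷ suc j) ++ z)
      ≡⟨ count-factors u (v ^ʷ suc j) x (y ^ʷ suc j) z ⟩
    count c u + (count c (v ^ʷ suc j) + (count c x + count c (y ^ʷ suc j)) + count c z)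
      ≡⟨ cong₂ (λ m n → count c u + (m + (count c x + n) + count c z))
               (count-^ʷ c v (suc j)) (count-^ʷ c y (suc j)) ⟩
    count c u + (suc j * count c v + (count c x + suc j * count c y) + count c z)
      ≡⟨ identity (count c u) (count c v) (count c x) (count c y) (count c z) j ⟩
    count c u + (count c v + (count c x + count c y) + count c z) + j * (count c v + count c y)
      ≡⟨ cong (_+ j * (count c v + count c y)) (count-factors u v x y z) ⟨
    count c (u ++ (v ++ x ++ y) ++ z) + j * (count c v + count c y)
      ∎
    where
      open ≡-Reasoning
      count-factors : ∀ u v x y z → count c (u ++ (v ++ x ++ y) ++ z) ≡
                                    count c u + (count c v + (count c x + count c y) + count c z)
      count-factors u v x y z = begin
        count c (u ++ (v ++ x ++ y) ++ z)                        ≡⟨ count-++ c u _ ⟩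
        count c u + count c ((v ++ x ++ y) ++ z)                 ≡⟨ cong (count c u +_) (count-++ c (v ++ x ++ y) z) ⟩
        count c u + (count c (v ++ x ++ y) + count c z)          ≡⟨ cong (λ n → count c u + (n + count c z))
                                                                      (trans (count-++ c v _) (cong (count c v +_) (count-++ c x y))) ⟩
        count c u + (count c v + (count c x + count c y) + count c z) ∎
      identity : ∀ u v x y z j → u + (suc j * v + (x + suc j * y) + z) ≡ u + (v + (x + y) + z) + j * (v + y)
      identity = solve-∀

  n∣count-^ʷ : ∀ c v n → n ∣ count c (v ^ʷ n)
  n∣count-^ʷ c v n = subst (n ∣_) (sym (count-^ʷ c v n)) (m∣m*n (count c v))

  coprime-counts⇒primitive : ∀ {a b w} → Coprime (count a w) (count b w) → Primitive w
  coprime-counts⇒primitive {a} {b} {w} a⊥b = empty , power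
    where
      empty : ¬ w ≡ []
      empty refl = 0≢1+n (a⊥b (∣-refl , ∣-refl))
      power : ¬ Σ _ λ v → Σ ℕ λ n → 2 ≤ n × w ≡ v ^ʷ n
      power (v , n , 2≤n , refl) = <⇒≢ 2≤n (sym (a⊥b (n∣count-^ʷ a v n , n∣count-^ʷ b v n)))

  module _ {a b : V} (a≢b : a ≢ b) where

    coprime-counts-∷ : ∀ {w} → RobustlyCoprime (count a w) (count b w) →
                       ∀ c → Coprime (count a (c ∷ w)) (count b (c ∷ w))
    coprime-counts-∷ {w} (a⊥b , 1+a⊥b , a⊥1+b) c with c ≟ a | c ≟ b
    ... | yes refl | _        = subst₂ Coprime (sym (count-∷-≡ a w)) (sym (count-∷-≢ w (≢-sym a≢b))) 1+a⊥b
    ... | no  c≢a  | yes refl = subst₂ Coprime (sym (count-∷-≢ w a≢b)) (sym (count-∷-≡ b w)) a⊥1+b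
    ... | no  c≢a  | no  c≢b  =
      subst₂ Coprime (sym (count-∷-≢ w (≢-sym c≢a))) (sym (count-∷-≢ w (≢-sym c≢b))) a⊥b

    robustly-coprime-counts⇒insRobust : ∀ {w} → RobustlyCoprime (count a w) (count b w) → InsRobust w
    robustly-coprime-counts⇒insRobust {w} robust = coprime-counts⇒primitive (proj₁ robust) , inserted
      where
        inserted : (i : ℕ) → i ≤ length w → (c : V) → Primitive (insertAt i w c)
        inserted i _ c = coprime-counts⇒primitive
          (subst₂ Coprime (sym (count-insertAt a i w c)) (sym (count-insertAt b i w c)) (coprime-counts-∷ robust c))

    length≡count+count : ∀ {w} → All (λ c → c ≡ a ⊎ c ≡ b) w → length w ≡ count a w + count b w
    length≡count+count []                       = refl
    length≡count+count {a ∷ w} (inj₁ refl ∷ ab) = begin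
      suc (length w)                        ≡⟨ cong suc (length≡count+count ab) ⟩
      suc (count a w + count b w)           ≡⟨ cong₂ _+_ (count-∷-≡ a w) (count-∷-≢ w (≢-sym a≢b)) ⟨
      count a (a ∷ w) + count b (a ∷ w)     ∎
      where open ≡-Reasoning
    length≡count+count {b ∷ w} (inj₂ refl ∷ ab) = begin
      suc (length w)                        ≡⟨ cong suc (length≡count+count ab) ⟩
      suc (count a w + count b w)           ≡⟨ +-suc (count a w) (count b w) ⟨
      count a w + suc (count b w)           ≡⟨ cong₂ _+_ (count-∷-≢ w a≢b) (count-∷-≡ b w) ⟨
      count a (b ∷ w) + count b (b ∷ w)     ∎
      where open ≡-Reasoning

split-trans : ∀ {A : Set} {y y′ y″ u v u′ v′ : List A} → y ≡ u ++ y′ ++ v → y′ ≡ u′ ++ y″ ++ v′ →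
              y ≡ (u ++ u′) ++ y″ ++ (v′ ++ v)
split-trans {y″ = y″} {u} {v} {u′} {v′} refl refl = begin
  u ++ (u′ ++ y″ ++ v′) ++ v     ≡⟨ cong (u ++_) (++-assoc u′ (y″ ++ v′) v) ⟩
  u ++ u′ ++ (y″ ++ v′) ++ v     ≡⟨ cong (λ s → u ++ u′ ++ s) (++-assoc y″ v′ v) ⟩
  u ++ u′ ++ y″ ++ v′ ++ v       ≡⟨ ++-assoc u u′ _ ⟨
  (u ++ u′) ++ y″ ++ (v′ ++ v)   ∎
  where open ≡-Reasoning

length-split : ∀ {A : Set} {y y′ u v : List A} → y ≡ u ++ y′ ++ v → length y ≡ length y′ + (length u + length v)
length-split {y′ = y′} {u} {v} refl = begin
  length (u ++ y′ ++ v)               ≡⟨ length-++ u ⟩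
  length u + length (y′ ++ v)         ≡⟨ cong (length u +_) (length-++ y′) ⟩
  length u + (length y′ + length v)   ≡⟨ x∙yz≈y∙xz (length u) (length y′) (length v) ⟩
  length y′ + (length u + length v)   ∎
  where
    open ≡-Reasoning

^ʷ-++-self : ∀ {A : Set} (v : List A) n → v ^ʷ n ++ v ≡ v ^ʷ suc n
^ʷ-++-self v zero    = sym (++-identityʳ v)
^ʷ-++-self v (suc n) = trans (++-assoc v (v ^ʷ n) v) (cong (v ++_) (^ʷ-++-self v n))

module Pumping {T : Set} (G : CFG T) where

  open CFG G

  Symbol : Set
  Symbol = Fin nN ⊎ T

  Tree : Fin nN → List T → Set
  Tree C y = Σ[ β ∈ List Symbol ] ((C , β) ∈ rules × Derives G β y)

  -- A derivation of α ⇒ u ++ y ++ v with a hole for a parse tree of B with yield y.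
  data Context (B : Fin nN) : List Symbol → List T → List T → Set where
    hole   : ∀ {α w} → Derives G α w → Context B (inj₁ B ∷ α) [] w
    term   : ∀ {a α u v} → Context B α u v → Context B (inj₂ a ∷ α) (a ∷ u) v
    inside : ∀ {A β α u v w} → (A , β) ∈ rules → Context B β u v → Derives G α w →
             Context B (inj₁ A ∷ α) u (v ++ w)
    later  : ∀ {A β α x u v} → (A , β) ∈ rules → Derives G β x → Context B α u v →
             Context B (inj₁ A ∷ α) (x ++ u) v

  TreeContext : Fin nN → Fin nN → List T → List T → Set
  TreeContext B C u v = Σ[ β ∈ List Symbol ] ((C , β) ∈ rules × Context B β u v)

  plug : ∀ {B α u v y} → Context B α u v → Tree B y → Derives G α (u ++ y ++ v)
  plug (hole d) (β , r , t) = nont r t d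
  plug (term c) t = term (plug c t)
  plug {u = u} {y = y} (inside {v = v} {w} r c d) t =
    subst (Derives G _) (trans (++-assoc u (y ++ v) w) (cong (u ++_) (++-assoc y v w))) (nont r (plug c t) d)
  plug {y = y} (later {x = x} {u} {v} r d c) t =
    subst (Derives G _) (sym (++-assoc x u (y ++ v))) (nont r d (plug c t))

  plugᵗ : ∀ {B C u v y} → TreeContext B C u v → Tree B y → Tree C (u ++ y ++ v)
  plugᵗ (β , r , c) t = β , r , plug c t

  compose : ∀ {B C α x z u v} → Context B α x z → TreeContext C B u v → Context C α (x ++ u) (v ++ z)
  compose (hole d) (β , r , c) = inside r c d
  compose (term c) t = term (compose c t)
  compose {v = v} (inside {v = v′} {w} r c d) t =
    subst (Context _ _ _) (++-assoc v v′ w) (inside r (compose c t) d)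
  compose {u = u} (later {x = x} {u′} r d c) t =
    subst (λ s → Context _ _ s _) (sym (++-assoc x u′ u)) (later r d (compose c t))

  composeᵗ : ∀ {B C D x z u v} → TreeContext B D x z → TreeContext C B u v → TreeContext C D (x ++ u) (v ++ z)
  composeᵗ (β , r , c) t = β , r , compose c t

  pump : ∀ {B x y z} → TreeContext B B x z → Tree B y → ∀ i → Tree B (x ^ʷ i ++ y ++ z ^ʷ i)
  pump c t zero    = subst (Tree _) (sym (++-identityʳ _)) t
  pump {x = x} {y} {z} c t (suc i) = subst (Tree _) unfold (plugᵗ c (pump c t i))
    where
      open ≡-Reasoning
      unfold : x ++ (x ^ʷ i ++ y ++ z ^ʷ i) ++ z ≡ x ^ʷ suc i ++ y ++ z ^ʷ suc i
      unfold = begin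
        x ++ (x ^ʷ i ++ y ++ z ^ʷ i) ++ z   ≡⟨ cong (x ++_) (++-assoc (x ^ʷ i) _ z) ⟩
        x ++ x ^ʷ i ++ (y ++ z ^ʷ i) ++ z   ≡⟨ cong (λ s → x ++ x ^ʷ i ++ s) (++-assoc y (z ^ʷ i) z) ⟩
        x ++ x ^ʷ i ++ y ++ z ^ʷ i ++ z     ≡⟨ cong (λ s → x ++ x ^ʷ i ++ y ++ s) (^ʷ-++-self z i) ⟩
        x ++ x ^ʷ i ++ y ++ z ^ʷ suc i      ≡⟨ ++-assoc x (x ^ʷ i) _ ⟨
        x ^ʷ suc i ++ y ++ z ^ʷ suc i       ∎

  size : ∀ {α w} → Derives G α w → ℕ
  size nil            = 0
  size (term d)       = suc (size d)
  size (nont r d₁ d₂) = suc (size d₁ + size d₂)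

  treeSize : ∀ {C y} → Tree C y → ℕ
  treeSize (β , r , d) = size d

  record MaxChild (α : List Symbol) (w : List T) (bound : ℕ) : Set where
    field
      C        : Fin nN
      u y′ v   : List T
      context  : Context C α u v
      subtree  : Tree C y′
      nested   : w ≡ u ++ y′ ++ v
      spread   : length w ≤ length α * length y′
      nonempty : 1 ≤ length y′
      smaller  : treeSize subtree < bound

  head-child : ∀ {A β α u w} (r : (A , β) ∈ rules) (d₁ : Derives G β u) (d₂ : Derives G α w) →
               1 ≤ length u → length w ≤ length α * length u →
               MaxChild (inj₁ A ∷ α) (u ++ w) (size (nont r d₁ d₂))
  head-child {u = u} r d₁ d₂ 1≤u w≤αu = record
    { C = _ ; u = [] ; y′ = u ; v = _ ; context = hole d₂ ; subtree = _ , r , d₁ ; nested = refl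
    ; spread = subst (_≤ _) (sym (length-++ u)) (+-monoʳ-≤ (length u) w≤αu)
    ; nonempty = 1≤u ; smaller = s≤s (m≤m+n (size d₁) (size d₂)) }

  max-child : ∀ {α w} (d : Derives G α w) → length w ≤ length α ⊎ MaxChild α w (size d)
  max-child nil = inj₁ z≤n
  max-child (term {a = a} d) with max-child d
  ... | inj₁ short = inj₁ (s≤s short)
  ... | inj₂ m     = inj₂ record
    { C = C ; u = a ∷ u ; y′ = y′ ; v = v ; context = term context ; subtree = subtree
    ; nested = cong (a ∷_) nested ; spread = +-mono-≤ nonempty spread ; nonempty = nonempty
    ; smaller = m<n⇒m<1+n smaller }
    where open MaxChild m
  max-child (nont {α = α} {u = u′} {w = w′} r d₁ d₂) with max-child d₂
  ... | inj₁ short with 1 ≤? length u′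
  ...   | yes 1≤u′ = inj₂ (head-child r d₁ d₂ 1≤u′ (≤-trans short (m≤m*n′ (length α) 1≤u′)))
    where
      m≤m*n′ : ∀ m {n} → 1 ≤ n → m ≤ m * n
      m≤m*n′ m 1≤n = ≤-trans (≤-reflexive (sym (*-identityʳ m))) (*-monoʳ-≤ m 1≤n)
  ...   | no  u′≱1 = inj₁ (subst (_≤ _) (sym (length-++ u′))
                       (≤-trans (≤-reflexive (cong (_+ length w′) (n<1⇒n≡0 (≰⇒> u′≱1)))) (m≤n⇒m≤1+n short)))
  max-child (nont {α = α} {u = u′} {w = w′} r d₁ d₂) | inj₂ m with length (MaxChild.y′ m) ≤? length u′
  ... | yes y′≤u′ =
    inj₂ (head-child r d₁ d₂ (≤-trans nonempty y′≤u′) (≤-trans spread (*-monoʳ-≤ (length α) y′≤u′)))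
    where open MaxChild m
  ... | no  y′≰u′ = inj₂ record
    { C = C ; u = u′ ++ u ; y′ = y′ ; v = v ; context = later r d₁ context ; subtree = subtree
    ; nested = trans (cong (u′ ++_) nested) (sym (++-assoc u′ u _))
    ; spread = subst (_≤ _) (sym (length-++ u′)) (+-mono-≤ (<⇒≤ (≰⇒> y′≰u′)) spread)
    ; nonempty = nonempty
    ; smaller = <-≤-trans smaller (m≤n⇒m≤1+n (m≤n+m (size d₂) (size d₁))) }
    where open MaxChild m

  ruleLengths : List (Fin nN × List Symbol) → ℕ
  ruleLengths []             = 0
  ruleLengths ((_ , β) ∷ rs) = length β + ruleLengths rs

  length≤ruleLengths : ∀ {rs A β} → (A , β) ∈ rs → length β ≤ ruleLengths rs
  length≤ruleLengths {(_ , β) ∷ rs} (here refl) = m≤m+n (length β) (ruleLengths rs)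
  length≤ruleLengths {(_ , β) ∷ rs} (there r)   = ≤-trans (length≤ruleLengths r) (m≤n+m (ruleLengths rs) (length β))

  width : ℕ
  width = suc (ruleLengths rules)

  rule-length≤width : ∀ {A β} → (A , β) ∈ rules → length β ≤ width
  rule-length≤width r = m≤n⇒m≤1+n (length≤ruleLengths r)

  record Branching (B : Fin nN) (y : List T) : Set where
    field
      C       : Fin nN
      u y′ v  : List T
      cone    : TreeContext C B u v
      subtree : Tree C y′
      nested  : y ≡ u ++ y′ ++ v
      proper  : 1 ≤ length u + length v
      spread  : length y ≤ width * length y′

  extend : ∀ {B C y y′ u v} → TreeContext C B u v → y ≡ u ++ y′ ++ v → length y ≤ length y′ →
           Branching C y′ → Branching B y
  extend {u = u₀} {v₀} c y≡uy′v y≤y′ b = record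
    { C = C ; u = u₀ ++ u ; y′ = y′ ; v = v ++ v₀
    ; cone = composeᵗ c cone ; subtree = subtree ; nested = split-trans {u = u₀} {v₀} {u} {v} y≡uy′v nested
    ; proper = ≤-trans proper (+-mono-≤ (length-++-≤ʳ u {u₀}) (length-++-≤ˡ v))
    ; spread = ≤-trans y≤y′ spread }
    where open Branching b

  branching-descendant : ∀ {B y} fuel (t : Tree B y) → treeSize t < fuel → length y ≤ width ⊎ Branching B y
  branching-descendant {y = y} (suc fuel) (β , r , d) size<fuel with max-child d
  ... | inj₁ short = inj₁ (≤-trans short (rule-length≤width r))
  ... | inj₂ m with 1 ≤? length (MaxChild.u m) + length (MaxChild.v m)
  ...   | yes proper = inj₂ record
    { C = C ; u = u ; y′ = y′ ; v = v ; cone = β , r , context ; subtree = subtree ; nested = nested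
    ; proper = proper ; spread = ≤-trans spread (*-monoˡ-≤ (length y′) (rule-length≤width r)) }
    where open MaxChild m
  ...   | no improper =
    Sum.map (subst (_≤ width) (sym y≡y′)) (extend (β , r , context) nested (≤-reflexive y≡y′))
      (branching-descendant fuel subtree (≤-trans smaller (≤-pred size<fuel)))
    where
      open MaxChild m
      y≡y′ : length y ≡ length y′
      y≡y′ = trans (length-split {u = u} {v} nested)
                   (trans (cong (length y′ +_) (n<1⇒n≡0 (≰⇒> improper))) (+-identityʳ _))

  branching-shorter : ∀ {B y} (b : Branching B y) → length (Branching.y′ b) < length y
  branching-shorter {y = y} b = begin-strict
    length y′                            <⟨ m<m+n (length y′) proper ⟩
    length y′ + (length u + length v)    ≡⟨ length-split {u = u} {v} nested ⟨
    length y                             ∎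
    where
      open Branching b
      open ≤-Reasoning

  L : ℕ
  L = width ^ suc nN

  width≤width^suc : ∀ n → width ≤ width ^ suc n
  width≤width^suc n =
    ≤-trans (≤-reflexive (sym (*-identityʳ width))) (*-monoʳ-≤ width (^-monoʳ-≤ width (z≤n {n})))

  power-bound-descends : ∀ n {m m′} → width ^ suc n < m → m ≤ width * m′ → width ^ n < m′
  power-bound-descends n big spread = *-cancelˡ-< width _ _ (<-≤-trans big spread)

  record Pump (w : List T) : Set where
    field
      u v x y z : List T
      proper : 1 ≤ length v + length y
      short  : length v + length y ≤ L
      word   : w ≡ u ++ (v ++ x ++ y) ++ z
      pumped : ∀ i → Generates G (u ++ (v ^ʷ i ++ x ++ y ^ʷ i) ++ z)

  Root : List Symbol
  Root = inj₁ start ∷ []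

  pump-at : ∀ {A B U V x y z} → A ≡ B → Context A Root U V → TreeContext B A x z → Tree B y →
            ∀ i → Generates G (U ++ (x ^ʷ i ++ y ++ z ^ʷ i) ++ V)
  pump-at refl root cone t i = plug root (pump cone t i)

  module Descent (w : List T) where

    record Occurrence : Set where
      field
        label                  : Fin nN
        prefix yield suffix    : List T
        context                : Context label Root prefix suffix
        tree                   : Tree label yield
        located                : w ≡ prefix ++ yield ++ suffix

    open Occurrence

    descend : (o : Occurrence) → Branching (label o) (yield o) → Occurrence
    descend o b = record
      { label = C ; prefix = prefix o ++ u ; yield = y′ ; suffix = v ++ suffix o
      ; context = compose (context o) cone ; tree = subtree
      ; located = split-trans {u = prefix o} {suffix o} {u} {v} (located o) nested }
      where open Branching b

    window : ∀ n (o : Occurrence) → length (yield o) ≤ n → width ^ nN < length (yield o) →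
             Σ[ o′ ∈ Occurrence ] (width ^ nN < length (yield o′) × length (yield o′) ≤ L)
    window zero    o y≤0 big = contradiction (≤-trans big y≤0) λ ()
    window (suc n) o y≤n big with length (yield o) ≤? L
    ... | yes short = o , big , short
    ... | no  long with branching-descendant (suc (treeSize (tree o))) (tree o) ≤-refl
    ...   | inj₁ narrow = contradiction (≤-trans narrow (width≤width^suc nN)) long
    ...   | inj₂ b      = window n (descend o b) (≤-pred (<-≤-trans (branching-shorter b) y≤n))
                            (power-bound-descends nN (≰⇒> long) (Branching.spread b))

    -- A branching ancestor of the current node, with the cone from it down to the node.
    record Visited (B : Fin nN) (y : List T) : Set where
      field
        ancestor   : Fin nN
        U y₀ V x z : List T
        root       : Context ancestor Root U V
        word       : w ≡ U ++ y₀ ++ V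
        short      : length y₀ ≤ L
        cone       : TreeContext B ancestor x z
        proper     : 1 ≤ length x + length z
        nested     : y₀ ≡ x ++ y ++ z

    visit : (o : Occurrence) → length (yield o) ≤ L → (b : Branching (label o) (yield o)) →
            Visited (Branching.C b) (Branching.y′ b)
    visit o short b = record
      { ancestor = label o ; U = prefix o ; y₀ = yield o ; V = suffix o ; x = u ; z = v
      ; root = context o ; word = located o ; short = short ; cone = cone ; proper = proper ; nested = nested }
      where open Branching b

    pass : ∀ {B y} (b : Branching B y) → Visited B y → Visited (Branching.C b) (Branching.y′ b)
    pass b e = record
      { ancestor = ancestor ; U = U ; y₀ = y₀ ; V = V ; x = x ++ Branching.u b ; z = Branching.v b ++ z
      ; root = root ; word = word ; short = short ; cone = composeᵗ cone (Branching.cone b)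
      ; proper = ≤-trans proper (+-mono-≤ (length-++-≤ˡ x) (length-++-≤ʳ z {Branching.v b}))
      ; nested = split-trans {u = x} {z} {Branching.u b} {Branching.v b} nested (Branching.nested b) }
      where open Visited e

    repeat⇒pump : ∀ {B y} → Tree B y → (e : Visited B y) → Visited.ancestor e ≡ B → Pump w
    repeat⇒pump {y = y} t e ancestor≡B = record
      { u = U ; v = x ; x = y ; y = z ; z = V ; proper = proper
      ; short = ≤-trans (≤-trans (m≤n+m _ (length y)) (≤-reflexive (sym (length-split {u = x} {z} nested)))) short
      ; word = trans word (cong (λ s → U ++ s ++ V) nested)
      ; pumped = pump-at ancestor≡B root cone t }
      where open Visited e

    Covers : ∀ {B y} → List (Visited B y) → Subset nN → Set
    Covers es rem = ∀ c → Any (λ e → Visited.ancestor e ≡ c) es ⊎ c ∈ₛ rem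

    -- rem contains the nonterminals not yet Visited. Each branching step divides the yield by at most
    -- width, so a Visited nonterminal recurs before rem is exhausted.
    find-repeat : ∀ n rem → ∣ rem ∣ ≤ n → (o : Occurrence) →
                  width ^ n < length (yield o) → length (yield o) ≤ L →
                  (es : List (Visited (label o) (yield o))) → Covers es rem → Pump w
    descend-fresh : ∀ n rem → ∣ rem ∣ ≤ n → (o : Occurrence) →
                    width ^ n < length (yield o) → length (yield o) ≤ L →
                    (es : List (Visited (label o) (yield o))) → Covers es rem → label o ∈ₛ rem → Pump w

    find-repeat n rem size o big short es covers with any? (λ e → Visited.ancestor e Fin.≟ label o) es
    ... | yes seen = let e , ancestor≡B = satisfied seen in repeat⇒pump (tree o) e ancestor≡B
    ... | no unseen = descend-fresh n rem size o big short es covers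
                        (Sum.[ (λ seen → contradiction seen unseen) , (λ fresh → fresh) ]′ (covers (label o)))

    descend-fresh zero    rem size o _ _ _ _ fresh = contradiction (≤-trans (x∈p⇒∣p-x∣<∣p∣ fresh) size) λ ()
    descend-fresh (suc n) rem size o big short es covers fresh
      with branching-descendant (suc (treeSize (tree o))) (tree o) ≤-refl
    ... | inj₁ narrow = contradiction (≤-trans narrow (width≤width^suc n)) (<⇒≱ big)
    ... | inj₂ b = find-repeat n (rem - label o) (≤-pred (≤-trans (x∈p⇒∣p-x∣<∣p∣ fresh) size)) (descend o b)
                     (power-bound-descends n big (Branching.spread b)) (≤-trans (<⇒≤ (branching-shorter b)) short)
                     (visit o short b ∷ map (pass b) es) covers′
      where
        covers′ : Covers (visit o short b ∷ map (pass b) es) (rem - label o)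
        covers′ c with c Fin.≟ label o
        ... | yes refl = inj₁ (here refl)
        ... | no  c≢B  = Sum.map (there ∘ map⁺) (λ c∈rem → x∈p∧x≢y⇒x∈p-y c∈rem c≢B) (covers c)

  pumping : ∀ {w} → Generates G w → L < length w → Pump w
  pumping {w} (nont {β = β} {u = u} r d nil) long =
    let o , big , short = window (length u) top ≤-refl u-big
    in find-repeat nN ⊤ (≤-reflexive (∣⊤∣≡n nN)) o big short [] (λ _ → inj₂ ∈⊤)
    where
      open Descent w
      top : Occurrence
      top = record { label = start ; prefix = [] ; yield = u ; suffix = [] ; context = hole nil
                   ; tree = β , r , d ; located = refl }
      u-big : width ^ nN < length u
      u-big = <-≤-trans (≤-<-trans (^-monoʳ-≤ width (n≤1+n nN)) long) (≤-reflexive (cong length (++-identityʳ u)))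

module NonContextFree {V : Set} (_≟_ : DecidableEquality V) {a b : V} (a≢b : a ≢ b) where

  open Counting _≟_

  OverAB : List V → Set
  OverAB = All (λ c → c ≡ a ⊎ c ≡ b)

  module Witness (p : ℕ) where

    open Exponents p

    block : List V
    block = b ∷ replicate (p * suc β + β) a

    witness : List V
    witness = block ++ (a ∷ block) ^ʷ K

    count-a-block : count a block ≡ p * suc β + β
    count-a-block = trans (count-∷-≢ _ a≢b) (count-replicate-≡ a _)

    count-b-block : count b block ≡ 1
    count-b-block = trans (count-∷-≡ b _) (cong suc (count-replicate-≢ (p * suc β + β) (≢-sym a≢b)))

    count-a : count a witness ≡ α
    count-a = begin
      count a witness                              ≡⟨ count-++ a block _ ⟩
      count a block + count a ((a ∷ block) ^ʷ K)   ≡⟨ cong (count a block +_) (count-^ʷ a (a ∷ block) K) ⟩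
      count a block + K * count a (a ∷ block)      ≡⟨ cong (λ n → count a block + K * n) (count-∷-≡ a block) ⟩
      count a block + K * suc (count a block)      ≡⟨ cong (λ n → n + K * suc n) count-a-block ⟩
      (p * suc β + β) + K * suc (p * suc β + β)    ≡⟨ identity K p ⟩
      α                                            ∎
      where
        open ≡-Reasoning
        identity : ∀ K p → (p * suc (suc K) + suc K) + K * suc (p * suc (suc K) + suc K) ≡
                           suc K + (K + p * suc K) * suc (suc K)
        identity = solve-∀

    count-b : count b witness ≡ β
    count-b = begin
      count b witness                              ≡⟨ count-++ b block _ ⟩
      count b block + count b ((a ∷ block) ^ʷ K)   ≡⟨ cong (count b block +_) (count-^ʷ b (a ∷ block) K) ⟩
      count b block + K * count b (a ∷ block)      ≡⟨ cong (λ n → count b block + K * n) (count-∷-≢ block (≢-sym a≢b)) ⟩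
      count b block + K * count b block            ≡⟨ cong (λ n → n + K * n) count-b-block ⟩
      1 + K * 1                                    ≡⟨ cong suc (*-identityʳ K) ⟩
      β                                            ∎
      where open ≡-Reasoning

    over-ab : OverAB witness
    over-ab = ++⁺ over-ab-block (concat⁺ (replicate⁺ K (inj₁ refl ∷ over-ab-block)))
      where
        over-ab-block : OverAB block
        over-ab-block = inj₂ refl ∷ replicate⁺ _ (inj₁ refl)

    witness∈QIbar : QIbar witness
    witness∈QIbar = coprime-counts⇒primitive (subst₂ Coprime (sym count-a) (sym count-b) α⊥β)
                  , λ (_ , inserted) → proj₂ (inserted 0 z≤n a) (a ∷ block , suc K , s≤s (1≤n! N) , refl)

    p<length : p < length witness
    p<length = begin-strict
      p                                  ≤⟨ ≤-trans (m≤m*n p (suc β)) (m≤m+n _ β) ⟩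
      p * suc β + β                      ≡⟨ length-replicate (p * suc β + β) ⟨
      length (replicate (p * suc β + β) a) <⟨ n<1+n _ ⟩
      length block                       ≤⟨ length-++-≤ˡ block ⟩
      length witness                     ∎
      where open ≤-Reasoning

  factors-over-ab : ∀ u v x y z → OverAB (u ++ (v ++ x ++ y) ++ z) → OverAB v × OverAB y
  factors-over-ab u v x y z ab = ++⁻ˡ v vxy , ++⁻ʳ x (++⁻ʳ v vxy)
    where
      vxy : OverAB (v ++ x ++ y)
      vxy = ++⁻ˡ (v ++ x ++ y) (++⁻ʳ u ab)

  length≡counts : ∀ {v y} → OverAB v → OverAB y →
                  length v + length y ≡ (count a v + count a y) + (count b v + count b y)
  length≡counts {v} {y} ab-v ab-y =
    trans (cong₂ _+_ (length≡count+count a≢b ab-v) (length≡count+count a≢b ab-y))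
          (interchange (count a v) (count b v) (count a y) (count b y))

  QIbar-not-context-free : ¬ ContextFree (QIbar {V})
  QIbar-not-context-free (G , generates⇔QIbar) = proj₂ w′∈QIbar (robustly-coprime-counts⇒insRobust a≢b robust)
    where
      open Pumping G using (L; pumping; module Pump)
      open Exponents L
      open Witness L
      open Pump (pumping (proj₂ (generates⇔QIbar witness) witness∈QIbar) p<length)
      s t : ℕ
      s = count a v + count a y
      t = count b v + count b y
      |vy|≡s+t : length v + length y ≡ s + t
      |vy|≡s+t = let ab-v , ab-y = factors-over-ab u v x y z (subst OverAB word over-ab) in length≡counts ab-v ab-y
      translated : ∃[ j ] RobustlyCoprime (α + j * s) (β + j * t)
      translated = translate s t (subst (1 ≤_) |vy|≡s+t proper) (subst (_≤ L) |vy|≡s+t short)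
      j : ℕ
      j = proj₁ translated
      w′ : List V
      w′ = u ++ (v ^ʷ suc j ++ x ++ y ^ʷ suc j) ++ z
      w′∈QIbar : QIbar w′
      w′∈QIbar = proj₁ (generates⇔QIbar w′) (pumped (suc j))
      count-w′ : ∀ c → count c w′ ≡ count c witness + j * (count c v + count c y)
      count-w′ c = trans (count-pumped c u v x y z j) (cong (λ w → count c w + j * (count c v + count c y)) (sym word))
      robust : RobustlyCoprime (count a w′) (count b w′)
      robust = subst₂ RobustlyCoprime (sym (trans (count-w′ a) (cong (_+ j * s) count-a)))
                                      (sym (trans (count-w′ b) (cong (_+ j * t) count-b)))
                                      (proj₂ translated)

lemma23 : (V : Set) (k : ℕ) → V ↔ Fin k → (a b : V) → a ≢ b →
    ¬ ContextFree (QIbar {V})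
lemma23 V k iso a b a≢b = NonContextFree.QIbar-not-context-free (via-injection (↔⇒↣ iso) Fin._≟_) a≢b
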